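{- Let $x\ge2$ be an integer. For $i\in\{1,2\}$ let $a_i,b_i\ge0$ be integers, $L_i=\{1^{a_i},x^{b_i}\}$ and $v_i=a_i+b_i+1$. Let $a=a_1+a_2$, $b=b_1+b_2$ and $y=a+b+1$. Suppose $L_1$ has a perfect linear realization and $L_2$ has a standard linear realization. Let $c\ge0$ be an integer and $v=a+b+c+1$. Then $\{1^a,x^b,y^c\}$ has a standard linear realization in each of the following cases: (i) $v_1$ is even and $v\equiv v_1\pmod y$; (ii) $v_1$ is odd and $v\equiv v_2+1\pmod y$.
   Context: For a positive integer $n$, $K_n$ is the complete graph on vertex set $\{0,\dots,n-1\}$ and the linear length of an edge $\{u,w\}$ is $|u-w|$. A multiset of positive integers of size $n-1$ has a linear realization if some Hamiltonian path in $K_n$ has multiset of linear edge lengths equal to it; it is standard if the path starts at $0$, and perfect if it starts at $0$ and ends at $n-1$. $\{x_1^{a_1},\dots\}$ denotes the multiset with $x_i$ of multiplicity $a_i$. -}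

module Defs where

open import Data.Nat using (ℕ; zero; suc; _+_; _∸_; _⊔_)
open import Data.List using (List; []; _∷_; length; upTo; replicate; _++_; last)
open import Data.Maybe using (Maybe; just)
open import Data.Product using (Σ; _×_)
open import Relation.Binary.PropositionalEquality using (_≡_)
open import Data.List.Relation.Binary.Permutation.Propositional using (_↭_)

∣_-_∣ : ℕ → ℕ → ℕ
∣ u - w ∣ = (u ∸ w) ⊔ (w ∸ u)

edgeLengths : List ℕ → List ℕ
edgeLengths [] = []
edgeLengths (u ∷ []) = []
edgeLengths (u ∷ w ∷ p) = ∣ u - w ∣ ∷ edgeLengths (w ∷ p)

HamPath : ℕ → List ℕ → Set
HamPath n p = p ↭ upTo n

-- a multiset L (as a list, up to permutation) of size n-1 is realized
-- by a Hamiltonian path in K_n with n = |L| + 1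
Realizes : List ℕ → List ℕ → Set
Realizes L p = HamPath (suc (length L)) p × (edgeLengths p ↭ L)

HasStandardRealization : List ℕ → Set
HasStandardRealization L =
  Σ (List ℕ) λ p → Σ (List ℕ) λ q → (p ≡ 0 ∷ q) × Realizes L p

HasPerfectRealization : List ℕ → Set
HasPerfectRealization L =
  Σ (List ℕ) λ p → Σ (List ℕ) λ q →
    (p ≡ 0 ∷ q) × (last p ≡ just (length L)) × Realizes L p

ms2 : ℕ → ℕ → ℕ → List ℕ
ms2 x a b = replicate a 1 ++ replicate b x

ms3 : ℕ → ℕ → ℕ → ℕ → ℕ → List ℕ
ms3 x y a b c = replicate a 1 ++ replicate b x ++ replicate c y

-- Let y = v₁ + v₂ - 1.  Following the perfect realization of L₁ and then the standard
-- realization of L₂ translated by v₁ - 1 gives a Hamiltonian path R of K_y with edge lengths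
-- L₁ ∪ L₂.  Write v = k * y + s with 0 < s ≤ y and stack {0, …, v - 1} in the y columns
-- r, r + y, r + 2y, …; the columns r < s have one vertex more than the others.  Visiting the
-- columns in the order of R, alternately upwards and downwards, is a Hamiltonian path of K_v
-- whose edges are vertical steps, of length y, and one step between consecutive columns r, r′,
-- of length |r - r′| if it is taken at the bottom, or at the top of two columns of equal height.
-- Heights change only where R passes from one realization to the other, and the parity of v₁
-- makes that step a bottom one.  In case (i) the snake follows R itself.  In case (ii) it starts
-- with the edge 0 → y and then covers {1, …, v - 1} along the reflection r ↦ y - 1 - r of R,
-- which moves L₂ into the tall columns and leaves v₁ - 1 (even) columns before the change.

module Submission where

open import Defs
open import Data.Nat as ℕ using (ℕ; zero; suc; _+_; _∸_; _*_; _≤_; _<_; _%_; _/_; pred; z≤n; s≤s; _<ᵇ_; NonZero; >-nonZero)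
open import Data.Nat.Properties
open import Data.Nat.DivMod using (m≡m%n+[m/n]*n; /-monoˡ-≤; n%n≡0; [m+n]%n≡m%n)
open import Algebra.Properties.CommutativeSemigroup +-commutativeSemigroup using (x∙yz≈y∙xz; interchange)
open import Data.Bool using (if_then_else_; true; false)
open import Data.Unit using (⊤; tt)
open import Data.Maybe using (just)
open import Data.Product using (Σ; _×_; _,_; proj₁; proj₂; uncurry)
open import Data.Sum using (_⊎_; inj₁; inj₂; [_,_]′)
open import Function using (id; _∘_)
open import Data.List
  using (List; []; _∷_; [_]; _++_; _∷ʳ_; map; replicate; length; upTo; downFrom; applyUpTo; applyDownFrom;
         concat; concatMap; reverse; last)
open import Data.List.Properties
  using (map-id; map-++; map-cong; map-cong-local; map-∘; map-upTo; map-applyUpTo; ++-assoc; ++-identityʳ;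
         length-++; length-map; length-replicate; length-upTo; reverse-applyUpTo; concatMap-pure; concatMap-++; upTo-∷ʳ)
open import Data.List.Relation.Unary.All as All using (All; []; _∷_)
import Data.List.Relation.Unary.All.Properties as Allₚ
open import Data.List.Relation.Binary.Permutation.Propositional
  using (_↭_; ↭-refl; ↭-sym; ↭-trans; ↭-reflexive; prep; module PermutationReasoning)
open import Data.List.Relation.Binary.Permutation.Propositional.Properties
  using (++⁺; ++⁺ˡ; ++⁺ʳ; shift; shifts; map⁺; drop-∷; drop-mid; ↭-reverse; ↭-length; All-resp-↭; ↭-empty-inv)
open import Relation.Binary.PropositionalEquality
  using (_≡_; refl; sym; trans; cong; cong₂; subst; subst₂; module ≡-Reasoning)
open import Relation.Nullary using (yes; no; contradiction)

-- Distances and edge lengths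

∣-∣≡ℕ∣-∣ : ∀ u w → ∣ u - w ∣ ≡ ℕ.∣ u - w ∣
∣-∣≡ℕ∣-∣ zero    zero    = refl
∣-∣≡ℕ∣-∣ zero    (suc w) = refl
∣-∣≡ℕ∣-∣ (suc u) zero    = refl
∣-∣≡ℕ∣-∣ (suc u) (suc w) = ∣-∣≡ℕ∣-∣ u w

∣n+u-n+w∣≡∣u-w∣ : ∀ n u w → ∣ n + u - n + w ∣ ≡ ∣ u - w ∣
∣n+u-n+w∣≡∣u-w∣ n u w = begin
  ∣ n + u - n + w ∣   ≡⟨ ∣-∣≡ℕ∣-∣ (n + u) (n + w) ⟩
  ℕ.∣ n + u - n + w ∣ ≡⟨ ∣m+n-m+o∣≡∣n-o∣ n u w ⟩
  ℕ.∣ u - w ∣         ≡⟨ ∣-∣≡ℕ∣-∣ u w ⟨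
  ∣ u - w ∣           ∎
  where open ≡-Reasoning

∣u-d+u∣≡d : ∀ u d → ∣ u - d + u ∣ ≡ d
∣u-d+u∣≡d u d = begin
  ∣ u - d + u ∣   ≡⟨ ∣-∣≡ℕ∣-∣ u (d + u) ⟩
  ℕ.∣ u - d + u ∣ ≡⟨ cong (λ v → ℕ.∣ u - v ∣) (+-comm d u) ⟩
  ℕ.∣ u - u + d ∣ ≡⟨ ∣m-m+n∣≡n u d ⟩
  d               ∎
  where open ≡-Reasoning

∣d+u-u∣≡d : ∀ u d → ∣ d + u - u ∣ ≡ d
∣d+u-u∣≡d u d = trans (⊔-comm (d + u ∸ u) (u ∸ (d + u))) (∣u-d+u∣≡d u d)

ℕ∣n∸u-n∸w∣≡∣u-w∣ : ∀ {n u w} → u ≤ n → w ≤ n → ℕ.∣ n ∸ u - n ∸ w ∣ ≡ ℕ.∣ u - w ∣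
ℕ∣n∸u-n∸w∣≡∣u-w∣ {n} {w = w} z≤n w≤n = trans (m≤n⇒∣n-m∣≡n∸m (m∸n≤m n w)) (m∸[m∸n]≡n w≤n)
ℕ∣n∸u-n∸w∣≡∣u-w∣ {n} {u} u≤n@(s≤s _) z≤n = begin
  ℕ.∣ n ∸ u - n ∣ ≡⟨ ∣-∣-comm (n ∸ u) n ⟩
  ℕ.∣ n - n ∸ u ∣ ≡⟨ ℕ∣n∸u-n∸w∣≡∣u-w∣ z≤n u≤n ⟩
  u               ∎
  where open ≡-Reasoning
ℕ∣n∸u-n∸w∣≡∣u-w∣ (s≤s u≤n) (s≤s w≤n) = ℕ∣n∸u-n∸w∣≡∣u-w∣ u≤n w≤n

∣n∸u-n∸w∣≡∣u-w∣ : ∀ {n u w} → u ≤ n → w ≤ n → ∣ n ∸ u - n ∸ w ∣ ≡ ∣ u - w ∣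
∣n∸u-n∸w∣≡∣u-w∣ {n} {u} {w} u≤n w≤n = begin
  ∣ n ∸ u - n ∸ w ∣   ≡⟨ ∣-∣≡ℕ∣-∣ (n ∸ u) (n ∸ w) ⟩
  ℕ.∣ n ∸ u - n ∸ w ∣ ≡⟨ ℕ∣n∸u-n∸w∣≡∣u-w∣ u≤n w≤n ⟩
  ℕ.∣ u - w ∣         ≡⟨ ∣-∣≡ℕ∣-∣ u w ⟨
  ∣ u - w ∣           ∎
  where open ≡-Reasoning

edgeLengths-∷ʳ-++ : ∀ xs u ys → edgeLengths ((xs ∷ʳ u) ++ ys) ≡ edgeLengths (xs ∷ʳ u) ++ edgeLengths (u ∷ ys)
edgeLengths-∷ʳ-++ []            u ys = refl
edgeLengths-∷ʳ-++ (x ∷ [])      u ys = refl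
edgeLengths-∷ʳ-++ (x ∷ x′ ∷ xs) u ys = cong (∣ x - x′ ∣ ∷_) (edgeLengths-∷ʳ-++ (x′ ∷ xs) u ys)

edgeLengths-map-+ : ∀ n p → edgeLengths (map (n +_) p) ≡ edgeLengths p
edgeLengths-map-+ n []          = refl
edgeLengths-map-+ n (u ∷ [])     = refl
edgeLengths-map-+ n (u ∷ w ∷ p) = cong₂ _∷_ (∣n+u-n+w∣≡∣u-w∣ n u w) (edgeLengths-map-+ n (w ∷ p))

edgeLengths-map-∸ : ∀ {n} p → All (_≤ n) p → edgeLengths (map (n ∸_) p) ≡ edgeLengths p
edgeLengths-map-∸ []          _                  = refl
edgeLengths-map-∸ (u ∷ [])    _                  = refl
edgeLengths-map-∸ (u ∷ w ∷ p) (u≤n ∷ w≤n ∷ p≤n) =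
  cong₂ _∷_ (∣n∸u-n∸w∣≡∣u-w∣ u≤n w≤n) (edgeLengths-map-∸ (w ∷ p) (w≤n ∷ p≤n))

length-edgeLengths : ∀ u p → length (edgeLengths (u ∷ p)) ≡ length p
length-edgeLengths u []      = refl
length-edgeLengths u (w ∷ p) = cong suc (length-edgeLengths w p)

module _ {d : ℕ} where

  edgeLengths-applyUpTo-++ : ∀ f → (∀ i → f (suc i) ≡ d + f i) → ∀ n zs →
    edgeLengths (applyUpTo f (suc n) ++ zs) ≡ replicate n d ++ edgeLengths (f n ∷ zs)
  edgeLengths-applyUpTo-++ f step zero    zs = refl
  edgeLengths-applyUpTo-++ f step (suc n) zs = cong₂ _∷_
    (trans (cong (λ v → ∣ f 0 - v ∣) (step 0)) (∣u-d+u∣≡d (f 0) d))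
    (edgeLengths-applyUpTo-++ (λ i → f (suc i)) (λ i → step (suc i)) n zs)

  edgeLengths-applyDownFrom-++ : ∀ f → (∀ i → f (suc i) ≡ d + f i) → ∀ n zs →
    edgeLengths (applyDownFrom f (suc n) ++ zs) ≡ replicate n d ++ edgeLengths (f 0 ∷ zs)
  edgeLengths-applyDownFrom-++ f step zero    zs = refl
  edgeLengths-applyDownFrom-++ f step (suc n) zs = cong₂ _∷_
    (trans (cong (λ v → ∣ v - f n ∣) (step n)) (∣d+u-u∣≡d (f n) d))
    (edgeLengths-applyDownFrom-++ f step n zs)

infix 4 _↭_⊕_⋆

_↭_⊕_⋆ : List ℕ → List ℕ → ℕ → Set
E ↭ F ⊕ d ⋆ = Σ ℕ λ N → E ↭ F ++ replicate N d

⊕⋆-[] : ∀ {d} → [] ↭ [] ⊕ d ⋆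
⊕⋆-[] = 0 , ↭-refl

⊕⋆-∷ : ∀ {d E F} x → E ↭ F ⊕ d ⋆ → x ∷ E ↭ x ∷ F ⊕ d ⋆
⊕⋆-∷ x (N , E↭) = N , prep x E↭

⊕⋆-replicate : ∀ {d E F} n → E ↭ F ⊕ d ⋆ → replicate n d ++ E ↭ F ⊕ d ⋆
⊕⋆-replicate zero    E↭ = E↭
⊕⋆-replicate {d} {F = F} (suc n) E↭ with ⊕⋆-replicate n E↭
... | N , dE↭ = suc N , ↭-trans (prep d dE↭) (↭-sym (shift d F (replicate N d)))

applyUpTo-cong : ∀ {f g : ℕ → ℕ} → (∀ i → f i ≡ g i) → ∀ n → applyUpTo f n ≡ applyUpTo g n
applyUpTo-cong {f} {g} f≗g n = trans (sym (map-upTo f n)) (trans (map-cong f≗g (upTo n)) (map-upTo g n))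

upTo-+ : ∀ m n → upTo (m + n) ≡ upTo m ++ map (m +_) (upTo n)
upTo-+ zero    n = sym (map-id (upTo n))
upTo-+ (suc m) n = cong (0 ∷_) (begin
  applyUpTo suc (m + n)                              ≡⟨ map-upTo suc (m + n) ⟨
  map suc (upTo (m + n))                             ≡⟨ cong (map suc) (upTo-+ m n) ⟩
  map suc (upTo m ++ map (m +_) (upTo n))            ≡⟨ map-++ suc (upTo m) _ ⟩
  map suc (upTo m) ++ map suc (map (m +_) (upTo n))  ≡⟨ cong₂ _++_ (map-upTo suc m) (sym (map-∘ (upTo n))) ⟩
  applyUpTo suc m ++ map (suc m +_) (upTo n)         ∎)
  where open ≡-Reasoning

upTo-suc : ∀ n → upTo (suc n) ≡ 0 ∷ map suc (upTo n)
upTo-suc n = cong (0 ∷_) (sym (map-upTo suc n))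

map-∸-upTo≡downFrom : ∀ n → map (n ∸_) (upTo (suc n)) ≡ downFrom (suc n)
map-∸-upTo≡downFrom zero    = refl
map-∸-upTo≡downFrom (suc n) = cong (suc n ∷_) (begin
  map (suc n ∸_) (applyUpTo suc (suc n))   ≡⟨ cong (map (suc n ∸_)) (map-upTo suc (suc n)) ⟨
  map (suc n ∸_) (map suc (upTo (suc n)))  ≡⟨ map-∘ (upTo (suc n)) ⟨
  map (n ∸_) (upTo (suc n))                ≡⟨ map-∸-upTo≡downFrom n ⟩
  downFrom (suc n)                         ∎)
  where open ≡-Reasoning

map-∸-upTo↭upTo : ∀ n → map (n ∸_) (upTo (suc n)) ↭ upTo (suc n)
map-∸-upTo↭upTo n = begin
  map (n ∸_) (upTo (suc n)) ≡⟨ map-∸-upTo≡downFrom n ⟩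
  downFrom (suc n)          ≡⟨ reverse-applyUpTo id (suc n) ⟨
  reverse (upTo (suc n))    ↭⟨ ↭-reverse (upTo (suc n)) ⟩
  upTo (suc n)              ∎
  where open PermutationReasoning

concatMap-↭ : ∀ (f : ℕ → List ℕ) {xs ys} → xs ↭ ys → concatMap f xs ↭ concatMap f ys
concatMap-↭ f _↭_.refl          = ↭-refl
concatMap-↭ f (prep x xs↭)      = ++⁺ˡ (f x) (concatMap-↭ f xs↭)
concatMap-↭ f (_↭_.swap x y xs↭) = ↭-trans (shifts (f x) (f y)) (++⁺ˡ (f y) (++⁺ˡ (f x) (concatMap-↭ f xs↭)))
concatMap-↭ f (_↭_.trans p q)   = ↭-trans (concatMap-↭ f p) (concatMap-↭ f q)

concatMap-shuffle : ∀ (g : ℕ → ℕ) (F : ℕ → List ℕ) xs →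
  concatMap (λ x → x ∷ map g (F x)) xs ↭ xs ++ map g (concatMap F xs)
concatMap-shuffle g F []       = ↭-refl
concatMap-shuffle g F (x ∷ xs) = prep x (begin
  map g (F x) ++ concatMap (λ x → x ∷ map g (F x)) xs ↭⟨ ++⁺ˡ (map g (F x)) (concatMap-shuffle g F xs) ⟩
  map g (F x) ++ xs ++ map g (concatMap F xs)         ↭⟨ shifts (map g (F x)) xs ⟩
  xs ++ map g (F x) ++ map g (concatMap F xs)         ≡⟨ cong (xs ++_) (map-++ g (F x) (concatMap F xs)) ⟨
  xs ++ map g (F x ++ concatMap F xs)                 ∎)
  where open PermutationReasoning

concatMap-congᴬ : ∀ {f g : ℕ → List ℕ} {xs} → All (λ x → f x ≡ g x) xs → concatMap f xs ≡ concatMap g xs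
concatMap-congᴬ f≗g = cong concat (map-cong-local f≗g)

last⇒∷ʳ : ∀ x xs {e} → last (x ∷ xs) ≡ just e → Σ (List ℕ) λ P₀ → x ∷ xs ≡ P₀ ∷ʳ e
last⇒∷ʳ x []        refl = [] , refl
last⇒∷ʳ x (x′ ∷ xs) eq with last⇒∷ʳ x′ xs eq
... | P₀ , x′∷xs≡ = x ∷ P₀ , cong (x ∷_) x′∷xs≡

drop-∷ʳ : ∀ {x : ℕ} xs ys → xs ∷ʳ x ↭ ys ∷ʳ x → xs ↭ ys
drop-∷ʳ xs ys xs∷ʳx↭ = ↭-trans (↭-reflexive (sym (++-identityʳ xs))) (↭-trans (drop-mid xs ys xs∷ʳx↭) (↭-reflexive (++-identityʳ ys)))

≡suc⇒≡suc-pred : ∀ {n m} → n ≡ suc m → n ≡ suc (pred n)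
≡suc⇒≡suc-pred refl = refl

-- Columns and snakes

module Columns (y : ℕ) where

  cell : ℕ → ℕ → ℕ
  cell r i = i * y + r

  cell-suc : ∀ r i → cell r (suc i) ≡ y + cell r i
  cell-suc r i = +-assoc y (i * y) r

  column : ℕ → ℕ → List ℕ
  column r h = applyUpTo (cell r) h

  column-suc : ∀ r h → column r (suc h) ≡ r ∷ map (y +_) (column r h)
  column-suc r h = cong (r ∷_) (trans (applyUpTo-cong (cell-suc r) h) (sym (map-applyUpTo (cell r) (y +_) h)))

  concatMap-column-0 : ∀ xs → concatMap (λ r → column r 0) xs ≡ []
  concatMap-column-0 []       = refl
  concatMap-column-0 (x ∷ xs) = concatMap-column-0 xs

  columns-cover : ∀ k s (h : ℕ → ℕ) → s ≤ y →
    (∀ {r} → r < s → h r ≡ suc k) → (∀ {r} → s ≤ r → r < y → h r ≡ k) →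
    concatMap (λ r → column r (h r)) (upTo y) ↭ upTo (k * y + s)
  columns-cover zero s h s≤y low high = ↭-reflexive (begin
    concatMap C (upTo y)                                     ≡⟨ cong (λ n → concatMap C (upTo n)) (m+[n∸m]≡n s≤y) ⟨
    concatMap C (upTo (s + (y ∸ s)))                          ≡⟨ cong (concatMap C) (upTo-+ s (y ∸ s)) ⟩
    concatMap C (upTo s ++ map (s +_) (upTo (y ∸ s)))         ≡⟨ concatMap-++ C (upTo s) _ ⟩
    concatMap C (upTo s) ++ concatMap C (map (s +_) (upTo (y ∸ s)))
      ≡⟨ cong₂ _++_ (concatMap-congᴬ (All.map (λ r<s → cong (column _) (low r<s)) (Allₚ.all-upTo s)))
                    (concatMap-congᴬ (Allₚ.map⁺ (All.map (λ i<y∸s → cong (column _) (high-part i<y∸s)) (Allₚ.all-upTo (y ∸ s))))) ⟩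
    concatMap [_] (upTo s) ++ concatMap (λ r → column r 0) (map (s +_) (upTo (y ∸ s)))
      ≡⟨ cong₂ _++_ (concatMap-pure (upTo s)) (concatMap-column-0 (map (s +_) (upTo (y ∸ s)))) ⟩
    upTo s ++ []                                              ≡⟨ ++-identityʳ (upTo s) ⟩
    upTo s                                                    ∎)
    where
    open ≡-Reasoning
    C : ℕ → List ℕ
    C r = column r (h r)
    high-part : ∀ {i} → i < y ∸ s → h (s + i) ≡ 0
    high-part {i} i<y∸s = high (m≤m+n s i) (subst (s + i <_) (m+[n∸m]≡n s≤y) (+-monoʳ-< s i<y∸s))
  columns-cover (suc k) s h s≤y low high = begin
    concatMap (λ r → column r (h r)) (upTo y)
      ≡⟨ concatMap-congᴬ (All.map (λ {r} r<y → trans (cong (column r) (h≡suc r<y)) (column-suc r (pred (h r)))) (Allₚ.all-upTo y)) ⟩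
    concatMap (λ r → r ∷ map (y +_) (column r (pred (h r)))) (upTo y)
      ↭⟨ concatMap-shuffle (y +_) (λ r → column r (pred (h r))) (upTo y) ⟩
    upTo y ++ map (y +_) (concatMap (λ r → column r (pred (h r))) (upTo y))
      ↭⟨ ++⁺ˡ (upTo y) (map⁺ (y +_) (columns-cover k s (λ r → pred (h r)) s≤y
                                       (λ r<s → cong pred (low r<s)) (λ s≤r r<y → cong pred (high s≤r r<y)))) ⟩
    upTo y ++ map (y +_) (upTo (k * y + s))   ≡⟨ upTo-+ y (k * y + s) ⟨
    upTo (y + (k * y + s))                   ≡⟨ cong upTo (+-assoc y (k * y) s) ⟨
    upTo (suc k * y + s)                     ∎
    where
    open PermutationReasoning
    h≡suc : ∀ {r} → r < y → h r ≡ suc (pred (h r))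
    h≡suc {r} r<y with r ℕ.<? s
    ... | yes r<s = ≡suc⇒≡suc-pred (low r<s)
    ... | no r≮s  = ≡suc⇒≡suc-pred (high (≮⇒≥ r≮s) r<y)

  module Meander (top : ℕ → ℕ) where

    ascend descend : ℕ → List ℕ
    ascend  r = applyUpTo     (cell r) (suc (top r))
    descend r = applyDownFrom (cell r) (suc (top r))

    mutual
      meanderUp : List ℕ → List ℕ
      meanderUp []       = []
      meanderUp (r ∷ rs) = ascend r ++ meanderDown rs

      meanderDown : List ℕ → List ℕ
      meanderDown []       = []
      meanderDown (r ∷ rs) = descend r ++ meanderUp rs

    mutual
      meanderUp-↭ : ∀ rs → meanderUp rs ↭ concatMap (λ r → column r (suc (top r))) rs
      meanderUp-↭ []       = ↭-refl
      meanderUp-↭ (r ∷ rs) = ++⁺ˡ (ascend r) (meanderDown-↭ rs)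

      meanderDown-↭ : ∀ rs → meanderDown rs ↭ concatMap (λ r → column r (suc (top r))) rs
      meanderDown-↭ []       = ↭-refl
      meanderDown-↭ (r ∷ rs) = ++⁺ descend↭ascend (meanderUp-↭ rs)
        where
        descend↭ascend : descend r ↭ ascend r
        descend↭ascend = ↭-trans (↭-reflexive (sym (reverse-applyUpTo (cell r) (suc (top r))))) (↭-reverse (ascend r))

    -- The snake turns at the top between the two columns of each pair (r, r′).
    LevelTops : List ℕ → Set
    LevelTops []            = ⊤
    LevelTops (r ∷ [])      = ⊤
    LevelTops (r ∷ r′ ∷ rs) = top r ≡ top r′ × LevelTops rs

    LevelTops-++ : ∀ {α β} A B → length A % 2 ≡ 0 →
      All (λ r → top r ≡ α) A → All (λ r → top r ≡ β) B → LevelTops (A ++ B)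
    LevelTops-++ []           B       _      _                 tops-B = levelled B tops-B
      where
      levelled : ∀ B → All (λ r → top r ≡ _) B → LevelTops B
      levelled []            _                     = tt
      levelled (r ∷ [])      _                     = tt
      levelled (r ∷ r′ ∷ rs) (tr ∷ tr′ ∷ tops-rs) = trans tr (sym tr′) , levelled rs tops-rs
    LevelTops-++ (a ∷ [])     B       ()     _                 _
    LevelTops-++ (a ∷ a′ ∷ A) B       even-A (ta ∷ ta′ ∷ tops-A) tops-B = trans ta (sym ta′) , LevelTops-++ A B even-A tops-A tops-B

    ascend-++ : ∀ r zs → edgeLengths (ascend r ++ zs) ≡ replicate (top r) y ++ edgeLengths (cell r (top r) ∷ zs)
    ascend-++ r = edgeLengths-applyUpTo-++ (cell r) (cell-suc r) (top r)

    descend-++ : ∀ r zs → edgeLengths (descend r ++ zs) ≡ replicate (top r) y ++ edgeLengths (r ∷ zs)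
    descend-++ r = edgeLengths-applyDownFrom-++ (cell r) (cell-suc r) (top r)

    ascend-descend-++ : ∀ r r′ zs → top r ≡ top r′ →
      edgeLengths (ascend r ++ descend r′ ++ zs) ≡ replicate (top r) y ++ ∣ r - r′ ∣ ∷ replicate (top r′) y ++ edgeLengths (r′ ∷ zs)
    ascend-descend-++ r r′ zs level = begin
      edgeLengths (ascend r ++ descend r′ ++ zs)
        ≡⟨ ascend-++ r (descend r′ ++ zs) ⟩
      replicate (top r) y ++ ∣ cell r (top r) - cell r′ (top r′) ∣ ∷ edgeLengths (descend r′ ++ zs)
        ≡⟨ cong (replicate (top r) y ++_) (cong₂ _∷_ tops-level (descend-++ r′ zs)) ⟩
      replicate (top r) y ++ ∣ r - r′ ∣ ∷ replicate (top r′) y ++ edgeLengths (r′ ∷ zs) ∎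
      where
      open ≡-Reasoning
      tops-level : ∣ cell r (top r) - cell r′ (top r′) ∣ ≡ ∣ r - r′ ∣
      tops-level = trans (cong (λ t → ∣ cell r (top r) - t * y + r′ ∣) (sym level)) (∣n+u-n+w∣≡∣u-w∣ (top r * y) r r′)

    mutual
      meanderUp-edgeLengths : ∀ rs → LevelTops rs → edgeLengths (meanderUp rs) ↭ edgeLengths rs ⊕ y ⋆
      meanderUp-edgeLengths []            _ = ⊕⋆-[]
      meanderUp-edgeLengths (r ∷ [])      _ =
        subst (_↭ [] ⊕ y ⋆) (sym (ascend-++ r [])) (⊕⋆-replicate (top r) ⊕⋆-[])
      meanderUp-edgeLengths (r ∷ r′ ∷ rs) (level , levels) =
        subst (_↭ edgeLengths (r ∷ r′ ∷ rs) ⊕ y ⋆) (sym (ascend-descend-++ r r′ (meanderUp rs) level))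
          (⊕⋆-replicate (top r) (⊕⋆-∷ ∣ r - r′ ∣ (⊕⋆-replicate (top r′) (meanderUp-edgeLengths-from r′ rs levels))))

      meanderUp-edgeLengths-from : ∀ u rs → LevelTops rs → edgeLengths (u ∷ meanderUp rs) ↭ edgeLengths (u ∷ rs) ⊕ y ⋆
      meanderUp-edgeLengths-from u []       _      = ⊕⋆-[]
      meanderUp-edgeLengths-from u (r ∷ rs) levels = ⊕⋆-∷ ∣ u - r ∣ (meanderUp-edgeLengths (r ∷ rs) levels)

module Snake (y k s : ℕ) where

  open Columns y

  -- Row of the top vertex of column r among the first k * y + s vertices; k = 0 is
  -- only used with s = y, when every column is tall.
  top : ℕ → ℕ
  top r = if r <ᵇ s then k else pred k

  open Meander top public

  top-< : ∀ {r} → r < s → top r ≡ k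
  top-< {r} r<s with r <ᵇ s | <⇒<ᵇ r<s
  ... | true | _ = refl

  top-≥ : ∀ {r} → s ≤ r → top r ≡ pred k
  top-≥ {r} s≤r with r <ᵇ s | <ᵇ⇒< r s
  ... | false | _     = refl
  ... | true  | r<s = contradiction (r<s tt) (≤⇒≯ s≤r)

  OnOneSide : List ℕ → Set
  OnOneSide rs = All (_< s) rs ⊎ All (s ≤_) rs

  OnOneSide⇒constant : ∀ {rs} → OnOneSide rs → Σ ℕ λ α → All (λ r → top r ≡ α) rs
  OnOneSide⇒constant (inj₁ low)  = k      , All.map top-< low
  OnOneSide⇒constant (inj₂ high) = pred k , All.map top-≥ high

  snake-edgeLengths : ∀ A B → length A % 2 ≡ 0 → OnOneSide A → OnOneSide B →
    edgeLengths (meanderUp (A ++ B)) ↭ edgeLengths (A ++ B) ⊕ y ⋆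
  snake-edgeLengths A B even-A side-A side-B with OnOneSide⇒constant side-A | OnOneSide⇒constant side-B
  ... | _ , tops-A | _ , tops-B = meanderUp-edgeLengths (A ++ B) (LevelTops-++ A B even-A tops-A tops-B)

  suc-top-≥ : ∀ {r} → 1 ≤ k ⊎ s ≡ y → s ≤ r → r < y → suc (top r) ≡ k
  suc-top-≥ (inj₁ 1≤k) s≤r r<y = trans (cong suc (top-≥ s≤r)) (suc-pred k {{>-nonZero 1≤k}})
  suc-top-≥ (inj₂ refl) s≤r r<y = contradiction r<y (≤⇒≯ s≤r)

  snake-↭ : ∀ {R} → s ≤ y → 1 ≤ k ⊎ s ≡ y → R ↭ upTo y → meanderUp R ↭ upTo (k * y + s)
  snake-↭ {R} s≤y nondegenerate R↭ = begin
    meanderUp R                                        ↭⟨ meanderUp-↭ R ⟩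
    concatMap (λ r → column r (suc (top r))) R         ↭⟨ concatMap-↭ _ R↭ ⟩
    concatMap (λ r → column r (suc (top r))) (upTo y)  ↭⟨ columns-cover k s (λ r → suc (top r)) s≤y
                                                             (λ r<s → cong suc (top-< r<s)) (suc-top-≥ nondegenerate) ⟩
    upTo (k * y + s)                                   ∎
    where open PermutationReasoning

-- The two constructions

%≡%⇒≡*+ : ∀ {V s} y .{{_ : NonZero y}} → s ≤ V → V % y ≡ s % y → Σ ℕ λ k → V ≡ k * y + s
%≡%⇒≡*+ {V} {s} y s≤V V%y≡s%y = V / y ∸ s / y , (begin
  V                                        ≡⟨ m≡m%n+[m/n]*n V y ⟩
  V % y + V / y * y                        ≡⟨ cong₂ _+_ V%y≡s%y (cong (_* y) (sym (m∸n+n≡m s/y≤V/y))) ⟩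
  s % y + (V / y ∸ s / y + s / y) * y       ≡⟨ cong (s % y +_) (*-distribʳ-+ y (V / y ∸ s / y) (s / y)) ⟩
  s % y + ((V / y ∸ s / y) * y + s / y * y) ≡⟨ x∙yz≈y∙xz (s % y) ((V / y ∸ s / y) * y) (s / y * y) ⟩
  (V / y ∸ s / y) * y + (s % y + s / y * y) ≡⟨ cong ((V / y ∸ s / y) * y +_) (m≡m%n+[m/n]*n s y) ⟨
  (V / y ∸ s / y) * y + s                  ∎)
  where
  open ≡-Reasoning
  s/y≤V/y : s / y ≤ V / y
  s/y≤V/y = /-monoˡ-≤ y s≤V

[1+n]%2≡1⇒n%2≡0 : ∀ n → suc n % 2 ≡ 1 → n % 2 ≡ 0
[1+n]%2≡1⇒n%2≡0 zero          _   = refl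
[1+n]%2≡1⇒n%2≡0 (suc zero)    ()
[1+n]%2≡1⇒n%2≡0 (suc (suc n)) odd = [1+n]%2≡1⇒n%2≡0 n odd

quotient-≢0 : ∀ {V k y s} → s < V → V ≡ k * y + s → 1 ≤ k
quotient-≢0 {k = zero}  s<V refl = contradiction s<V (<-irrefl refl)
quotient-≢0 {k = suc k} _   _    = s≤s z≤n

quotient-≢0⊎remainder≡divisor : ∀ {V k y s} → y ≤ V → s ≤ y → V ≡ k * y + s → 1 ≤ k ⊎ s ≡ y
quotient-≢0⊎remainder≡divisor {k = zero}  y≤V s≤y refl = inj₂ (≤-antisym s≤y y≤V)
quotient-≢0⊎remainder≡divisor {k = suc k} _   _   _    = inj₁ (s≤s z≤n)

join-↭ : ∀ {e f P q} → P ↭ upTo (suc e) → 0 ∷ q ↭ upTo (suc f) → P ++ map (e +_) q ↭ upTo (suc (e + f))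
join-↭ {e} {f} {P} {q} P↭ 0∷q↭ = begin
  P ++ map (e +_) q                         ↭⟨ ++⁺ P↭ (map⁺ (e +_) (drop-∷ 0∷q↭)) ⟩
  upTo (suc e) ++ map (e +_) (applyUpTo suc f) ≡⟨ cong (upTo (suc e) ++_) shifted ⟩
  upTo (suc e) ++ map (suc e +_) (upTo f)   ≡⟨ upTo-+ (suc e) f ⟨
  upTo (suc (e + f))                        ∎
  where
  open PermutationReasoning
  shifted : map (e +_) (applyUpTo suc f) ≡ map (suc e +_) (upTo f)
  shifted = trans (map-applyUpTo suc (e +_) f) (trans (applyUpTo-cong (+-suc e) f) (sym (map-upTo (suc e +_) f)))

join-edgeLengths : ∀ {P P₀ e} q → P ≡ P₀ ∷ʳ e → edgeLengths (P ++ map (e +_) q) ≡ edgeLengths P ++ edgeLengths (0 ∷ q)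
join-edgeLengths {P₀ = P₀} {e} q refl = trans (edgeLengths-∷ʳ-++ P₀ e (map (e +_) q)) (cong (edgeLengths (P₀ ∷ʳ e) ++_) (begin
  edgeLengths (e ∷ map (e +_) q)     ≡⟨ cong (λ v → edgeLengths (v ∷ map (e +_) q)) (+-identityʳ e) ⟨
  edgeLengths (map (e +_) (0 ∷ q))   ≡⟨ edgeLengths-map-+ e (0 ∷ q) ⟩
  edgeLengths (0 ∷ q)                ∎))
  where open ≡-Reasoning

PaddedStandardRealization : ℕ → ℕ → List ℕ → Set
PaddedStandardRealization d V E = Σ (List ℕ) λ q → (0 ∷ q ↭ upTo V) × (edgeLengths (0 ∷ q) ↭ E ⊕ d ⋆)

paddedRealization-v₁-even : ∀ e f c {q₁ q₂ P₀} → 0 ∷ q₁ ≡ P₀ ∷ʳ e →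
  0 ∷ q₁ ↭ upTo (suc e) → 0 ∷ q₂ ↭ upTo (suc f) →
  suc e % 2 ≡ 0 → (suc (e + f) + c) % suc (e + f) ≡ suc e % suc (e + f) →
  PaddedStandardRealization (suc (e + f)) (suc (e + f) + c) (edgeLengths (0 ∷ q₁) ++ edgeLengths (0 ∷ q₂))
paddedRealization-v₁-even e f c {q₁} {q₂} {P₀} P≡ P↭ Q↭ even residue =
  _ , subst (λ V → meanderUp R ↭ upTo V) (sym V≡) (snake-↭ s≤y nondegenerate (join-↭ P↭ Q↭)) , edges
  where
  y : ℕ
  y = suc (e + f)
  s≤y : suc e ≤ y
  s≤y = s≤s (m≤m+n e f)
  quotient : Σ ℕ λ k → y + c ≡ k * y + suc e
  quotient = %≡%⇒≡*+ y (≤-trans s≤y (m≤m+n y c)) residue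
  k : ℕ
  k = proj₁ quotient
  V≡ : y + c ≡ k * y + suc e
  V≡ = proj₂ quotient
  nondegenerate : 1 ≤ k ⊎ suc e ≡ y
  nondegenerate = quotient-≢0⊎remainder≡divisor (m≤m+n y c) s≤y V≡
  open Snake y k (suc e)
  R : List ℕ
  R = (0 ∷ q₁) ++ map (e +_) q₂
  low : All (_< suc e) (0 ∷ q₁)
  low = All-resp-↭ (↭-sym P↭) (Allₚ.all-upTo (suc e))
  high : All (suc e ≤_) (map (e +_) q₂)
  high = Allₚ.map⁺ (All.map (λ {t} 1≤t → subst (_≤ e + t) (+-comm e 1) (+-monoʳ-≤ e 1≤t)) positive)
    where
    positive : All (1 ≤_) q₂
    positive = All-resp-↭ (↭-sym (drop-∷ Q↭)) (Allₚ.applyUpTo⁺₁ suc f (λ _ → s≤s z≤n))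
  even-P : length (0 ∷ q₁) % 2 ≡ 0
  even-P = subst (λ n → n % 2 ≡ 0) (trans (sym (length-upTo (suc e))) (sym (↭-length P↭))) even
  edges : edgeLengths (meanderUp R) ↭ edgeLengths (0 ∷ q₁) ++ edgeLengths (0 ∷ q₂) ⊕ y ⋆
  edges = subst (λ E → edgeLengths (meanderUp R) ↭ E ⊕ y ⋆) (join-edgeLengths q₂ P≡)
            (snake-edgeLengths (0 ∷ q₁) (map (e +_) q₂) even-P (inj₁ low) (inj₂ high))

n%n≡[1+n]%n⇒n≡1 : ∀ n .{{_ : NonZero n}} → n % n ≡ suc n % n → n ≡ 1
n%n≡[1+n]%n⇒n≡1 (suc zero)    _        = refl
n%n≡[1+n]%n⇒n≡1 n@(suc (suc _)) residues = contradiction (trans (sym (n%n≡0 n)) (trans residues ([m+n]%n≡m%n 1 n))) λ ()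

2+f≤2+e+f+c : ∀ e f c → suc (suc f) ≤ suc (suc e + f) + c
2+f≤2+e+f+c e f c = s≤s (s≤s (≤-trans (m≤n+m f e) (m≤m+n (e + f) c)))

All-<⇒All-∸-≥ : ∀ e f {xs} → All (_< e) xs → All (suc f ≤_) (map (e + f ∸_) xs)
All-<⇒All-∸-≥ e f = Allₚ.map⁺ ∘ All.map λ {t} t<e →
  m+n≤o⇒m≤o∸n (suc f) (subst (_≤ e + f) (cong suc (+-comm t f)) (+-monoˡ-< f t<e))

All-≥⇒All-∸-< : ∀ e f {xs} → All (e ≤_) xs → All (_< suc f) (map (e + f ∸_) xs)
All-≥⇒All-∸-< e f = Allₚ.map⁺ ∘ All.map λ {u} e≤u →
  s≤s (subst (e + f ∸ u ≤_) (m+n∸m≡n e f) (∸-monoʳ-≤ (e + f) e≤u))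

nondegenerate-v₁-odd : ∀ e f c k → suc e % 2 ≡ 1 → e + f + c ≡ k * suc (e + f) + suc f → 1 ≤ k ⊎ suc f ≡ suc (e + f)
nondegenerate-v₁-odd zero          f c k _  _  = inj₂ refl
nondegenerate-v₁-odd (suc zero)    f c k () _
nondegenerate-v₁-odd (suc (suc e)) f c k _ V≡ = inj₁ (quotient-≢0 (2+f≤2+e+f+c e f c) V≡)

paddedRealization-v₁-odd-v₂<v : ∀ e f c {q₁ q₂ P₀} → 0 ∷ q₁ ≡ P₀ ∷ʳ e →
  0 ∷ q₁ ↭ upTo (suc e) → 0 ∷ q₂ ↭ upTo (suc f) → suc (suc f) ≤ suc (e + f) + c →
  suc e % 2 ≡ 1 → (suc (e + f) + c) % suc (e + f) ≡ suc (suc f) % suc (e + f) →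
  PaddedStandardRealization (suc (e + f)) (suc (e + f) + c) (edgeLengths (0 ∷ q₁) ++ edgeLengths (0 ∷ q₂))
paddedRealization-v₁-odd-v₂<v e f c {q₁} {q₂} {P₀} P≡ P↭ Q↭ 2+f≤V odd residue =
  _ , subst (λ V → 0 ∷ map suc (meanderUp R′) ↭ upTo (suc V)) (sym V′≡) vertices , edges
  where
  n y : ℕ
  n = e + f
  y = suc n
  quotient : Σ ℕ λ k → y + c ≡ k * y + suc (suc f)
  quotient = %≡%⇒≡*+ y 2+f≤V residue
  k : ℕ
  k = proj₁ quotient
  V′≡ : n + c ≡ k * y + suc f
  V′≡ = suc-injective (trans (proj₂ quotient) (+-suc (k * y) (suc f)))
  open Snake y k (suc f)
  Q R R′ A B : List ℕ
  Q = map (e +_) q₂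
  R = (0 ∷ q₁) ++ Q
  R↭ : R ↭ upTo y
  R↭ = join-↭ P↭ Q↭
  R′ = map (n ∸_) R
  vertices : 0 ∷ map suc (meanderUp R′) ↭ upTo (suc (k * y + suc f))
  vertices = ↭-trans (prep 0 (map⁺ suc (snake-↭ (s≤s (m≤n+m f e)) (nondegenerate-v₁-odd e f c k odd V′≡)
                                                  (↭-trans (map⁺ (n ∸_) R↭) (map-∸-upTo↭upTo n)))))
                     (↭-reflexive (sym (upTo-suc (k * y + suc f))))
  P₀↭ : P₀ ↭ upTo e
  P₀↭ = drop-∷ʳ P₀ (upTo e) (↭-trans (↭-reflexive (sym P≡)) (↭-trans P↭ (↭-reflexive (sym (upTo-∷ʳ e)))))
  A = map (n ∸_) P₀
  B = map (n ∸_) (e ∷ Q)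
  R′≡ : R′ ≡ A ++ B
  R′≡ = trans (cong (λ P → map (n ∸_) (P ++ Q)) P≡) (trans (cong (map (n ∸_)) (++-assoc P₀ [ e ] Q)) (map-++ (n ∸_) P₀ (e ∷ Q)))
  even-A : length A % 2 ≡ 0
  even-A = subst (λ m → m % 2 ≡ 0) (sym (trans (length-map (n ∸_) P₀) (trans (↭-length P₀↭) (length-upTo e))))
                 ([1+n]%2≡1⇒n%2≡0 e odd)
  high-A : All (suc f ≤_) A
  high-A = All-<⇒All-∸-≥ e f (All-resp-↭ (↭-sym P₀↭) (Allₚ.all-upTo e))
  low-B : All (_< suc f) B
  low-B = All-≥⇒All-∸-< e f (≤-refl ∷ Allₚ.map⁺ (All.universal (m≤m+n e) q₂))
  R′-edges : edgeLengths R′ ≡ edgeLengths (0 ∷ q₁) ++ edgeLengths (0 ∷ q₂)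
  R′-edges = trans (edgeLengths-map-∸ R (All.map ≤-pred (All-resp-↭ (↭-sym R↭) (Allₚ.all-upTo y)))) (join-edgeLengths q₂ P≡)
  edges : edgeLengths (0 ∷ map suc (meanderUp R′)) ↭ edgeLengths (0 ∷ q₁) ++ edgeLengths (0 ∷ q₂) ⊕ y ⋆
  edges = ⊕⋆-replicate 1 (subst₂ (λ E F → E ↭ F ⊕ y ⋆) (sym (edgeLengths-map-+ 1 (meanderUp R′))) R′-edges
            (subst (λ X → edgeLengths (meanderUp X) ↭ edgeLengths X ⊕ y ⋆) (sym R′≡)
              (snake-edgeLengths A B even-A (inj₂ high-A) (inj₁ low-B))))

paddedRealization-v₁-odd : ∀ e f c {q₁ q₂ P₀} → 0 ∷ q₁ ≡ P₀ ∷ʳ e →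
  0 ∷ q₁ ↭ upTo (suc e) → 0 ∷ q₂ ↭ upTo (suc f) →
  suc e % 2 ≡ 1 → (suc (e + f) + c) % suc (e + f) ≡ suc (suc f) % suc (e + f) →
  PaddedStandardRealization (suc (e + f)) (suc (e + f) + c) (edgeLengths (0 ∷ q₁) ++ edgeLengths (0 ∷ q₂))
-- For e = c = 0 we have v = y, so y divides 1 and all three paths are the single vertex 0.
paddedRealization-v₁-odd zero f zero _ P↭ Q↭ _ residue
  with n%n≡[1+n]%n⇒n≡1 (suc f) (subst (λ m → m % suc f ≡ suc (suc f) % suc f) (+-identityʳ (suc f)) residue)
... | refl with ↭-empty-inv (drop-∷ P↭) | ↭-empty-inv (drop-∷ Q↭)
... | refl | refl = [] , ↭-refl , ⊕⋆-[]
paddedRealization-v₁-odd zero f (suc c) P≡ P↭ Q↭ odd residue =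
  paddedRealization-v₁-odd-v₂<v zero f (suc c) P≡ P↭ Q↭ (s≤s (subst (suc f ≤_) (sym (+-suc f c)) (s≤s (m≤m+n f c)))) odd residue
paddedRealization-v₁-odd (suc e) f c P≡ P↭ Q↭ odd residue =
  paddedRealization-v₁-odd-v₂<v (suc e) f c P≡ P↭ Q↭ (2+f≤2+e+f+c e f c) odd residue

padded⇒standard : ∀ {d c L E} → E ↭ L → PaddedStandardRealization d (suc (length L + c)) E →
  HasStandardRealization (L ++ replicate c d)
padded⇒standard {d} {c} {L} {E} E↭L (q , V↭ , N , edges↭) = 0 ∷ q , q , refl , vertices , edges
  where
  length-L++ : length (L ++ replicate c d) ≡ length L + c
  length-L++ = trans (length-++ L) (cong (length L +_) (length-replicate c))
  N≡c : N ≡ c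
  N≡c = +-cancelˡ-≡ (length L) N c (begin
    length L + N                        ≡⟨ cong₂ _+_ (↭-length E↭L) (length-replicate N) ⟨
    length E + length (replicate N d)   ≡⟨ length-++ E ⟨
    length (E ++ replicate N d)         ≡⟨ ↭-length edges↭ ⟨
    length (edgeLengths (0 ∷ q))        ≡⟨ length-edgeLengths 0 q ⟩
    length q                            ≡⟨ suc-injective (trans (↭-length V↭) (length-upTo _)) ⟩
    length L + c                        ∎)
    where open ≡-Reasoning
  vertices : 0 ∷ q ↭ upTo (suc (length (L ++ replicate c d)))
  vertices = subst (λ n → 0 ∷ q ↭ upTo (suc n)) (sym length-L++) V↭
  edges : edgeLengths (0 ∷ q) ↭ L ++ replicate c d
  edges = ↭-trans edges↭ (++⁺ E↭L (↭-reflexive (cong (λ n → replicate n d) N≡c)))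

HasStandardRealization-++-replicate : ∀ {L₁ L₂} c → HasPerfectRealization L₁ → HasStandardRealization L₂ →
  let v₁ = suc (length L₁); v₂ = suc (length L₂); y = suc (length L₁ + length L₂) in
  v₁ % 2 ≡ 0 × (y + c) % y ≡ v₁ % y ⊎ v₁ % 2 ≡ 1 × (y + c) % y ≡ suc v₂ % y →
  HasStandardRealization ((L₁ ++ L₂) ++ replicate c y)
HasStandardRealization-++-replicate {L₁} {L₂} c (_ , q₁ , refl , last₁ , P↭ , edges₁) (_ , q₂ , refl , Q↭ , edges₂) cases =
  padded⇒standard (++⁺ edges₁ edges₂) (subst (λ n → PaddedStandardRealization y (suc (n + c)) E) (sym (length-++ L₁)) padded)
  where
  y : ℕ
  y = suc (length L₁ + length L₂)
  E : List ℕ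
  E = edgeLengths (0 ∷ q₁) ++ edgeLengths (0 ∷ q₂)
  split : Σ (List ℕ) λ P₀ → 0 ∷ q₁ ≡ P₀ ∷ʳ length L₁
  split = last⇒∷ʳ 0 q₁ last₁
  padded : PaddedStandardRealization y (y + c) E
  padded = [ uncurry (paddedRealization-v₁-even _ _ c (proj₂ split) P↭ Q↭)
           , uncurry (paddedRealization-v₁-odd  _ _ c (proj₂ split) P↭ Q↭) ]′ cases

replicate-+ : ∀ m n (x : ℕ) → replicate (m + n) x ≡ replicate m x ++ replicate n x
replicate-+ zero    n x = refl
replicate-+ (suc m) n x = cong (x ∷_) (replicate-+ m n x)

length-ms2 : ∀ x a b → length (ms2 x a b) ≡ a + b
length-ms2 x a b = trans (length-++ (replicate a 1)) (cong₂ _+_ (length-replicate a) (length-replicate b))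

ms2-++ : ∀ x a₁ b₁ a₂ b₂ → ms2 x a₁ b₁ ++ ms2 x a₂ b₂ ↭ ms2 x (a₁ + a₂) (b₁ + b₂)
ms2-++ x a₁ b₁ a₂ b₂ = begin
  (replicate a₁ 1 ++ replicate b₁ x) ++ (replicate a₂ 1 ++ replicate b₂ x) ≡⟨ ++-assoc (replicate a₁ 1) _ _ ⟩
  replicate a₁ 1 ++ replicate b₁ x ++ replicate a₂ 1 ++ replicate b₂ x   ↭⟨ ++⁺ˡ (replicate a₁ 1) (shifts (replicate b₁ x) (replicate a₂ 1)) ⟩
  replicate a₁ 1 ++ replicate a₂ 1 ++ replicate b₁ x ++ replicate b₂ x   ≡⟨ ++-assoc (replicate a₁ 1) _ _ ⟨
  (replicate a₁ 1 ++ replicate a₂ 1) ++ replicate b₁ x ++ replicate b₂ x ≡⟨ cong₂ _++_ (replicate-+ a₁ a₂ 1) (replicate-+ b₁ b₂ x) ⟨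
  replicate (a₁ + a₂) 1 ++ replicate (b₁ + b₂) x                        ∎
  where open PermutationReasoning

ms2-++-replicate↭ms3 : ∀ x a₁ b₁ a₂ b₂ c y → (ms2 x a₁ b₁ ++ ms2 x a₂ b₂) ++ replicate c y ↭ ms3 x y (a₁ + a₂) (b₁ + b₂) c
ms2-++-replicate↭ms3 x a₁ b₁ a₂ b₂ c y = ↭-trans (++⁺ʳ (replicate c y) (ms2-++ x a₁ b₁ a₂ b₂))
  (↭-reflexive (++-assoc (replicate (a₁ + a₂) 1) (replicate (b₁ + b₂) x) (replicate c y)))

HasStandardRealization-↭ : ∀ {L L′} → L ↭ L′ → HasStandardRealization L → HasStandardRealization L′
HasStandardRealization-↭ L↭L′ (p , q , p≡ , p↭ , edges↭) =
  p , q , p≡ , subst (λ n → p ↭ upTo (suc n)) (↭-length L↭L′) p↭ , ↭-trans edges↭ L↭L′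

residues-normalise : ∀ {e f c n e′ f′} → e′ ≡ e → f′ ≡ f → n ≡ e′ + f′ →
  (e′ + 1) % 2 ≡ 0 × (n + c + 1) % suc n ≡ (e′ + 1) % suc n ⊎ (e′ + 1) % 2 ≡ 1 × (n + c + 1) % suc n ≡ (f′ + 1 + 1) % suc n →
  suc e % 2 ≡ 0 × (suc (e + f) + c) % suc (e + f) ≡ suc e % suc (e + f) ⊎
  suc e % 2 ≡ 1 × (suc (e + f) + c) % suc (e + f) ≡ suc (suc f) % suc (e + f)
residues-normalise {e} {f} {c} refl refl refl cases
  rewrite +-comm (e + f + c) 1 | +-comm e 1 | +-comm f 1 | +-comm (suc f) 1 = cases

lemma3p2 : (x a₁ b₁ a₂ b₂ c : ℕ) → 2 ≤ x →
    HasPerfectRealization (ms2 x a₁ b₁) →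
    HasStandardRealization (ms2 x a₂ b₂) →
    ((a₁ + b₁ + 1) % 2 ≡ 0
        × (a₁ + a₂ + (b₁ + b₂) + c + 1) % suc (a₁ + a₂ + (b₁ + b₂)) ≡ (a₁ + b₁ + 1) % suc (a₁ + a₂ + (b₁ + b₂))
      ⊎ (a₁ + b₁ + 1) % 2 ≡ 1
        × (a₁ + a₂ + (b₁ + b₂) + c + 1) % suc (a₁ + a₂ + (b₁ + b₂)) ≡ (a₂ + b₂ + 1 + 1) % suc (a₁ + a₂ + (b₁ + b₂))) →
    HasStandardRealization (ms3 x (a₁ + a₂ + (b₁ + b₂) + 1) (a₁ + a₂) (b₁ + b₂) c)
lemma3p2 x a₁ b₁ a₂ b₂ c _ perfect standard cases =
  HasStandardRealization-↭ (ms2-++-replicate↭ms3 x a₁ b₁ a₂ b₂ c _)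
    (subst (λ y → HasStandardRealization ((ms2 x a₁ b₁ ++ ms2 x a₂ b₂) ++ replicate c y)) y≡
      (HasStandardRealization-++-replicate c perfect standard
        (residues-normalise (sym (length-ms2 x a₁ b₁)) (sym (length-ms2 x a₂ b₂)) (interchange a₁ a₂ b₁ b₂) cases)))
  where
  y≡ : suc (length (ms2 x a₁ b₁) + length (ms2 x a₂ b₂)) ≡ a₁ + a₂ + (b₁ + b₂) + 1
  y≡ = trans (cong suc (trans (cong₂ _+_ (length-ms2 x a₁ b₁) (length-ms2 x a₂ b₂)) (sym (interchange a₁ a₂ b₁ b₂))))
             (+-comm 1 (a₁ + a₂ + (b₁ + b₂)))
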